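{- Let $n$ be a positive integer with $100 \mid n$. Then: (1) if $\mathrm{lnzd}(n^n) = 6$, then $\mathrm{rbln}(n^n) = 7$; (2) if $\mathrm{lnzd}(n^n) = 5$, then $\mathrm{rbln}(n^n) = 2$; (3) if $\mathrm{lnzd}(n^n) = 1$, then $\mathrm{rbln}(n^n) = 0$.
   Context: For a positive integer $m$ written in base $10$, $\mathrm{lnzd}(m)$ denotes the last (rightmost) non-zero decimal digit of $m$. Also $\mathrm{rbln}(m)$ is defined as follows: if $m$ has exactly one non-zero decimal digit, then $\mathrm{rbln}(m)=0$; if $m$ has at least two non-zero decimal digits, then $\mathrm{rbln}(m)$ is the decimal digit immediately to the left of the last non-zero digit of $m$ (this digit may itself be $0$). For example, $\mathrm{rbln}(1000)=0$ and $\mathrm{rbln}(10504200)=4$. -}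

module Defs where

open import Data.Nat using (ℕ; zero; suc; _<ᵇ_)
open import Data.Nat.DivMod using (_/_; _%_)
open import Data.Bool using (if_then_else_)

-- Remove trailing decimal zeros from m, using fuel (fuel = m suffices, since
-- each step divides a positive number by 10).
stripZerosAux : ℕ → ℕ → ℕ
stripZerosAux zero    m = m
stripZerosAux (suc f) zero = zero
stripZerosAux (suc f) (suc k) with suc k % 10
... | zero  = stripZerosAux f (suc k / 10)
... | suc _ = suc k

stripZeros : ℕ → ℕ
stripZeros m = stripZerosAux m m

lnzd : ℕ → ℕ
lnzd m = stripZeros m % 10

-- digit immediately left of the last non-zero digit; 0 if m has exactly one
-- non-zero digit (i.e. stripZeros m < 10)
rbln : ℕ → ℕ
rbln m = if stripZeros m <ᵇ 10 then 0 else (stripZeros m / 10) % 10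

-- Write n = m * 10 ^ b with 10 ∤ m. Then n ^ n = m ^ n * 10 ^ (b * n), so removing the
-- trailing zeros of n ^ n leaves m ^ n, whose last two digits decide lnzd and rbln. As
-- 100 ∣ n, m ^ n is a positive power of m ^ 100, and for 10 ∤ m the residue of m ^ 100
-- modulo 100 is one of the nonzero idempotents 1, 25, 76 of ℤ/100ℤ (checked on all
-- residues), so m ^ n ≡ m ^ 100 (mod 100) ends in 01, 25 or 76.
module Submission where

open import Defs
open import Data.Nat using (ℕ; _^_; _≤_)
open import Data.Nat.Divisibility using (_∣_)
open import Data.Product using (_×_)
open import Relation.Binary.PropositionalEquality using (_≡_)

open import Data.Bool using (true; false; if_then_else_; T)
open import Data.Fin using (Fin; toℕ; fromℕ<)
open import Data.Fin.Properties using (all?; toℕ-fromℕ<)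
open import Data.List using (List; []; _∷_)
open import Data.List.Membership.Propositional using (_∈_)
open import Data.List.Membership.DecPropositional Data.Nat._≟_ using (_∈?_)
open import Data.List.Relation.Unary.Any using (here; there)
open import Data.Nat
  using (zero; suc; _*_; _<_; _%_; _/_; _<ᵇ_; NonZero; >-nonZero; ≢-nonZero; ≢-nonZero⁻¹; z<s; s<s; s≤s)
open import Data.Nat.DivMod
open import Data.Nat.Divisibility using (divides; m%n≡0⇒n∣m)
open import Data.Nat.Induction using (<-wellFounded)
open import Data.Nat.Properties
open import Algebra.Properties.CommutativeSemigroup *-commutativeSemigroup
  using (interchange; x∙yz≈xz∙y; xy∙z≈x∙zy)
open import Data.Product using (_,_; ∃₂)
open import Induction.WellFounded using (Acc; acc)
open import Relation.Binary.PropositionalEquality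
  using (_≢_; refl; sym; trans; cong; subst; module ≡-Reasoning)
open import Relation.Nullary.Negation using (contradiction)
open import Relation.Nullary.Decidable using (yes; no; toWitness; ¬?; _→-dec_)

^-distribʳ-* : ∀ m n o → (m * n) ^ o ≡ m ^ o * n ^ o
^-distribʳ-* m n zero    = refl
^-distribʳ-* m n (suc o) =
  trans (cong (m * n *_) (^-distribʳ-* m n o)) (interchange m n (m ^ o) (n ^ o))

n<m^n : ∀ m n → 1 < m → n < m ^ n
n<m^n m         zero    _   = z<s
n<m^n m@(suc _) (suc n) 1<m = begin-strict
  suc n     ≤⟨ n<m^n m n 1<m ⟩
  m ^ n     <⟨ m<m*n (m ^ n) m {{m^n≢0 m n}} 1<m ⟩
  m ^ n * m ≡⟨ *-comm (m ^ n) m ⟩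
  m * m ^ n ∎
  where open ≤-Reasoning

^-%-distribˡ : ∀ m e d .{{_ : NonZero d}} → m ^ e % d ≡ (m % d) ^ e % d
^-%-distribˡ m zero    d = refl
^-%-distribˡ m (suc e) d = begin
  m * m ^ e % d                       ≡⟨ %-distribˡ-* m (m ^ e) d ⟩
  m % d * (m ^ e % d) % d             ≡⟨ cong (λ x → m % d * x % d) (^-%-distribˡ m e d) ⟩
  m % d * ((m % d) ^ e % d) % d       ≡⟨ cong (λ x → x * ((m % d) ^ e % d) % d) (m%n%n≡m%n m d) ⟨
  m % d % d * ((m % d) ^ e % d) % d   ≡⟨ %-distribˡ-* (m % d) ((m % d) ^ e) d ⟨
  m % d * (m % d) ^ e % d             ∎
  where open ≡-Reasoning

^-suc-%-idempotent : ∀ x v d .{{_ : NonZero d}} → x % d ≡ v → v * v % d ≡ v →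
                     ∀ k → x ^ suc k % d ≡ v
^-suc-%-idempotent x v d x%d≡v v²≡v zero    = trans (cong (_% d) (*-identityʳ x)) x%d≡v
^-suc-%-idempotent x v d x%d≡v v²≡v (suc k) = begin
  x * x ^ suc k % d               ≡⟨ %-distribˡ-* x (x ^ suc k) d ⟩
  x % d * (x ^ suc k % d) % d     ≡⟨ cong (λ y → x % d * y % d) (^-suc-%-idempotent x v d x%d≡v v²≡v k) ⟩
  x % d * v % d                   ≡⟨ cong (λ y → y * v % d) x%d≡v ⟩
  v * v % d                       ≡⟨ v²≡v ⟩
  v                               ∎
  where open ≡-Reasoning

m%100%10≡m%10 : ∀ m → m % 100 % 10 ≡ m % 10
m%100%10≡m%10 m = m∣n⇒o%n%m≡o%m 10 100 m (divides 10 refl)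

%10≢0⇒nonZero : ∀ {t} → t % 10 ≢ 0 → NonZero t
%10≢0⇒nonZero t%10≢0 = ≢-nonZero λ t≡0 → t%10≢0 (cong (_% 10) t≡0)

split-trailing-zeros : ∀ n .{{_ : NonZero n}} → ∃₂ λ m b → m % 10 ≢ 0 × n ≡ m * 10 ^ b
split-trailing-zeros n = go n (<-wellFounded n)
  where
  go : ∀ n .{{_ : NonZero n}} → Acc _<_ n → ∃₂ λ m b → m % 10 ≢ 0 × n ≡ m * 10 ^ b
  go n (acc rec) with n % 10 ≟ 0
  ... | no n%10≢0 = n , 0 , n%10≢0 , sym (*-identityʳ n)
  ... | yes n%10≡0 with go (n / 10) {{n/10≢0}} (rec (m/n<m n 10 (s<s z<s)))
    where
    n/10≢0 : NonZero (n / 10)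
    n/10≢0 = ≢-nonZero λ n/10≡0 →
      ≢-nonZero⁻¹ n (trans (sym (m/n*n≡m (m%n≡0⇒n∣m n 10 n%10≡0))) (cong (_* 10) n/10≡0))
  ... | m , b , m%10≢0 , n/10≡m*10^b = m , suc b , m%10≢0 , (begin
    n              ≡⟨ m/n*n≡m (m%n≡0⇒n∣m n 10 n%10≡0) ⟨
    n / 10 * 10    ≡⟨ cong (_* 10) n/10≡m*10^b ⟩
    m * 10 ^ b * 10 ≡⟨ xy∙z≈x∙zy m (10 ^ b) 10 ⟩
    m * 10 ^ suc b ∎)
    where open ≡-Reasoning

stripZerosAux-fixes : ∀ f x → x % 10 ≢ 0 → stripZerosAux f x ≡ x
stripZerosAux-fixes zero    x       _      = refl
stripZerosAux-fixes (suc f) zero    0≢0    = contradiction refl 0≢0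
stripZerosAux-fixes (suc f) (suc k) x%10≢0 with suc k % 10
... | zero  = contradiction refl x%10≢0
... | suc _ = refl

stripZerosAux-*10 : ∀ f y .{{_ : NonZero y}} → stripZerosAux (suc f) (y * 10) ≡ stripZerosAux f y
stripZerosAux-*10 f y@(suc _) with y * 10 % 10 | m*n%n≡0 y 10
... | .0 | refl = cong (stripZerosAux f) (m*n/n≡m y 10)

stripZerosAux-*10^ : ∀ {f} t j → t % 10 ≢ 0 → j ≤ f → stripZerosAux f (t * 10 ^ j) ≡ t
stripZerosAux-*10^ {f} t zero t%10≢0 _ =
  trans (cong (stripZerosAux f) (*-identityʳ t)) (stripZerosAux-fixes f t t%10≢0)
stripZerosAux-*10^ {suc f} t (suc j) t%10≢0 (s≤s j≤f) = begin
  stripZerosAux (suc f) (t * (10 * 10 ^ j)) ≡⟨ cong (stripZerosAux (suc f)) (x∙yz≈xz∙y t 10 (10 ^ j)) ⟩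
  stripZerosAux (suc f) (t * 10 ^ j * 10)   ≡⟨ stripZerosAux-*10 f (t * 10 ^ j) ⟩
  stripZerosAux f (t * 10 ^ j)              ≡⟨ stripZerosAux-*10^ t j t%10≢0 j≤f ⟩
  t                                         ∎
  where
  open ≡-Reasoning
  instance
    t*10^j≢0 : NonZero (t * 10 ^ j)
    t*10^j≢0 = m*n≢0 t (10 ^ j) {{%10≢0⇒nonZero t%10≢0}} {{m^n≢0 10 j}}

stripZeros-*10^ : ∀ t j → t % 10 ≢ 0 → stripZeros (t * 10 ^ j) ≡ t
stripZeros-*10^ t j t%10≢0 = stripZerosAux-*10^ t j t%10≢0 (begin
  j          ≤⟨ <⇒≤ (n<m^n 10 j (s<s z<s)) ⟩
  10 ^ j     ≤⟨ m≤n*m (10 ^ j) t ⟩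
  t * 10 ^ j ∎)
  where
  open ≤-Reasoning
  instance _ = %10≢0⇒nonZero t%10≢0

tens-digit : ∀ t → (if t <ᵇ 10 then 0 else t / 10 % 10) ≡ t % 100 / 10
tens-digit t with t <ᵇ 10 in t<ᵇ10
... | true  = sym (begin
  t % 100 / 10 ≡⟨ cong (_/ 10) (m<n⇒m%n≡m (<-≤-trans t<10 (m≤n+m 10 90))) ⟩
  t / 10       ≡⟨ m<n⇒m/n≡0 t<10 ⟩
  0            ∎)
  where
  open ≡-Reasoning
  t<10 : t < 10
  t<10 = <ᵇ⇒< t 10 (subst T (sym t<ᵇ10) _)
... | false = sym (m%[n*o]/o≡m/o%n t 10 10)

lnzd≡stripZeros-%100-%10 : ∀ m → lnzd m ≡ stripZeros m % 100 % 10
lnzd≡stripZeros-%100-%10 m = sym (m%100%10≡m%10 (stripZeros m))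

rbln≡stripZeros-%100-/10 : ∀ m → rbln m ≡ stripZeros m % 100 / 10
rbln≡stripZeros-%100-/10 m = tens-digit (stripZeros m)

nonzeroIdempotents₁₀₀ : List ℕ
nonzeroIdempotents₁₀₀ = 1 ∷ 25 ∷ 76 ∷ []

idempotent-%100 : ∀ {v} → v ∈ nonzeroIdempotents₁₀₀ → v * v % 100 ≡ v
idempotent-%100 (here refl)                 = refl
idempotent-%100 (there (here refl))         = refl
idempotent-%100 (there (there (here refl))) = refl

idempotent-%10≢0 : ∀ {v} → v ∈ nonzeroIdempotents₁₀₀ → v % 10 ≢ 0
idempotent-%10≢0 (here refl)                 ()
idempotent-%10≢0 (there (here refl))         ()
idempotent-%10≢0 (there (there (here refl))) ()

digits-of-nonzeroIdempotent : ∀ {v} → v ∈ nonzeroIdempotents₁₀₀ →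
  (v % 10 ≡ 6 → v / 10 ≡ 7) × (v % 10 ≡ 5 → v / 10 ≡ 2) × (v % 10 ≡ 1 → v / 10 ≡ 0)
digits-of-nonzeroIdempotent (here refl)                 = (λ ()) , (λ ()) , (λ _ → refl)
digits-of-nonzeroIdempotent (there (here refl))         = (λ ()) , (λ _ → refl) , (λ ())
digits-of-nonzeroIdempotent (there (there (here refl))) = (λ _ → refl) , (λ ()) , (λ ())

^100-%100-table : ∀ (r : Fin 100) → toℕ r % 10 ≢ 0 →
                  toℕ r ^ 100 % 100 ∈ nonzeroIdempotents₁₀₀
^100-%100-table = toWitness {a? = all? λ r →
  ¬? (toℕ r % 10 ≟ 0) →-dec (toℕ r ^ 100 % 100 ∈? nonzeroIdempotents₁₀₀)} _

^100-%100 : ∀ m → m % 10 ≢ 0 → m ^ 100 % 100 ∈ nonzeroIdempotents₁₀₀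
^100-%100 m m%10≢0 = subst (_∈ nonzeroIdempotents₁₀₀) (sym (^-%-distribˡ m 100 100)) [m%100]^100∈
  where
  r = fromℕ< (m%n<n m 100)
  r≡m%100 : toℕ r ≡ m % 100
  r≡m%100 = toℕ-fromℕ< (m%n<n m 100)
  r%10≢0 : toℕ r % 10 ≢ 0
  r%10≢0 = subst (λ x → x % 10 ≢ 0) (sym r≡m%100) (subst (_≢ 0) (sym (m%100%10≡m%10 m)) m%10≢0)
  [m%100]^100∈ : (m % 100) ^ 100 % 100 ∈ nonzeroIdempotents₁₀₀
  [m%100]^100∈ = subst (λ x → x ^ 100 % 100 ∈ nonzeroIdempotents₁₀₀) r≡m%100 (^100-%100-table r r%10≢0)

^[100*suc]-%100 : ∀ m c → m % 10 ≢ 0 → m ^ (100 * suc c) % 100 ∈ nonzeroIdempotents₁₀₀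
^[100*suc]-%100 m c m%10≢0 = subst (_∈ nonzeroIdempotents₁₀₀) (sym mⁿ%100≡m¹⁰⁰%100) m¹⁰⁰∈
  where
  m¹⁰⁰∈ = ^100-%100 m m%10≢0
  mⁿ%100≡m¹⁰⁰%100 : m ^ (100 * suc c) % 100 ≡ m ^ 100 % 100
  mⁿ%100≡m¹⁰⁰%100 = trans (cong (_% 100) (sym (^-*-assoc m 100 (suc c))))
    (^-suc-%-idempotent (m ^ 100) _ 100 refl (idempotent-%100 m¹⁰⁰∈) c)

stripZeros-n^n-%100 : ∀ n → 1 ≤ n → 100 ∣ n → stripZeros (n ^ n) % 100 ∈ nonzeroIdempotents₁₀₀
stripZeros-n^n-%100 n 1≤n (divides zero n≡0) = contradiction (sym n≡0) (<⇒≢ 1≤n)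
stripZeros-n^n-%100 n 1≤n (divides (suc c) n≡[1+c]*100)
  with split-trailing-zeros n {{>-nonZero 1≤n}}
... | m , b , m%10≢0 , n≡m*10^b = subst (λ t → t % 100 ∈ nonzeroIdempotents₁₀₀) (sym stripZeros-nⁿ) mⁿ∈
  where
  open ≡-Reasoning
  mⁿ∈ : m ^ n % 100 ∈ nonzeroIdempotents₁₀₀
  mⁿ∈ = subst (λ e → m ^ e % 100 ∈ nonzeroIdempotents₁₀₀)
    (sym (trans n≡[1+c]*100 (*-comm (suc c) 100))) (^[100*suc]-%100 m c m%10≢0)
  nⁿ≡mⁿ*10^[b*n] : n ^ n ≡ m ^ n * 10 ^ (b * n)
  nⁿ≡mⁿ*10^[b*n] = begin
    n ^ n                ≡⟨ cong (_^ n) n≡m*10^b ⟩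
    (m * 10 ^ b) ^ n     ≡⟨ ^-distribʳ-* m (10 ^ b) n ⟩
    m ^ n * (10 ^ b) ^ n ≡⟨ cong (m ^ n *_) (^-*-assoc 10 b n) ⟩
    m ^ n * 10 ^ (b * n) ∎
  mⁿ%10≢0 : m ^ n % 10 ≢ 0
  mⁿ%10≢0 mⁿ%10≡0 = idempotent-%10≢0 mⁿ∈ (trans (m%100%10≡m%10 (m ^ n)) mⁿ%10≡0)
  stripZeros-nⁿ : stripZeros (n ^ n) ≡ m ^ n
  stripZeros-nⁿ = trans (cong stripZeros nⁿ≡mⁿ*10^[b*n]) (stripZeros-*10^ (m ^ n) (b * n) mⁿ%10≢0)

lemma2p1 : (n : ℕ) → 1 ≤ n → 100 ∣ n →
    ((lnzd (n ^ n) ≡ 6 → rbln (n ^ n) ≡ 7) ×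
     (lnzd (n ^ n) ≡ 5 → rbln (n ^ n) ≡ 2) ×
     (lnzd (n ^ n) ≡ 1 → rbln (n ^ n) ≡ 0))
lemma2p1 n 1≤n 100∣n
  rewrite lnzd≡stripZeros-%100-%10 (n ^ n) | rbln≡stripZeros-%100-/10 (n ^ n)
  = digits-of-nonzeroIdempotent (stripZeros-n^n-%100 n 1≤n 100∣n)
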